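{- Let $X$ be a finite contractible $T_0$-space. Then $d(X)\le |X|-1$.
   Context: Finite $T_0$-spaces are identified with finite posets via the order $x\le y$ iff $x$ belongs to every open set containing $y$. A space is contractible if it is homotopy equivalent to a point. The $2$-dimension $d(X)$ of a finite $T_0$-space $X$ is the minimum $n\in\mathbb{N}_0$ such that $X$ is homeomorphic to a subspace of $\mathfrak{S}^n$, where $\mathfrak{S}=\{0,1\}$ is the Sierpinski space with unique proper nonempty open set $\{0\}$; equivalently, the minimum $n$ such that $X$ embeds as a subposet of $\{0,1\}^n$ with the product order. $|X|$ denotes the cardinality of $X$. -}

module Defs where

open import Level using (0ℓ)
open import Data.Nat using (ℕ)
open import Data.Fin using (Fin)
open import Data.Bool using (Bool)
import Data.Bool as B
open import Data.Unit using (⊤)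
open import Data.Product using (Σ; ∃; _×_)
open import Data.Sum using (_⊎_)
open import Function using (_∘_; id)
open import Relation.Binary.PropositionalEquality using (_≡_)
open import Relation.Binary.Definitions using (Decidable)
open import Relation.Binary.Structures using (IsPartialOrder)
open import Relation.Binary.Construct.Closure.ReflexiveTransitive using (Star)

-- A finite T₀-space, identified (as in the paper) with a finite poset:
-- carrier Fin card, with x ≤ y iff x lies in every open set containing y.
-- Decidability of the order is automatic classically for a finite space.
record FinT0 : Set₁ where
  field
    card    : ℕ
    _≤_     : Fin card → Fin card → Set
    isPO    : IsPartialOrder _≡_ _≤_
    dec≤    : Decidable _≤_

open FinT0 public

-- Continuous maps between finite T₀-spaces = order-preserving maps.
Continuous : (X Y : FinT0) → (Fin (card X) → Fin (card Y)) → Set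
Continuous X Y f = ∀ {x y} → _≤_ X x y → _≤_ Y (f x) (f y)

Map : FinT0 → FinT0 → Set
Map X Y = Σ (Fin (card X) → Fin (card Y)) (Continuous X Y)

fun : ∀ {X Y} → Map X Y → Fin (card X) → Fin (card Y)
fun f = Data.Product.proj₁ f

idMap : (X : FinT0) → Map X X
idMap X = id Data.Product., λ p → p

comp : (X Y Z : FinT0) → Map Y Z → Map X Y → Map X Z
comp X Y Z (g Data.Product., gc) (f Data.Product., fc) = (g ∘ f) Data.Product., (λ p → gc (fc p))

-- Pointwise order on maps (the order of the finite mapping space Y^X).
PointwiseLe : (X Y : FinT0) → Map X Y → Map X Y → Set
PointwiseLe X Y f g = ∀ x → _≤_ Y (fun {X} {Y} f x) (fun {X} {Y} g x)

Comparable : (X Y : FinT0) → Map X Y → Map X Y → Set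
Comparable X Y f g = PointwiseLe X Y f g ⊎ PointwiseLe X Y g f

-- Homotopy of maps between finite T₀-spaces: f ≃ g iff they lie in the same
-- path component of Y^X, i.e. there is a fence f = f₀ ≤ f₁ ≥ f₂ ≤ … fₖ = g.
Homotopic : (X Y : FinT0) → Map X Y → Map X Y → Set
Homotopic X Y = Star (Comparable X Y)

HomotopyEquivalent : FinT0 → FinT0 → Set
HomotopyEquivalent X Y =
  Σ (Map X Y) λ f → Σ (Map Y X) λ g →
    Homotopic X X (comp X Y X g f) (idMap X) ×
    Homotopic Y Y (comp Y X Y f g) (idMap Y)

pointT0 : FinT0
pointT0 = record
  { card = 1
  ; _≤_ = λ _ _ → ⊤
  ; isPO = record
      { isPreorder = record
          { isEquivalence = Relation.Binary.PropositionalEquality.isEquivalence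
          ; reflexive = λ _ → Data.Unit.tt
          ; trans = λ _ _ → Data.Unit.tt }
      ; antisym = λ { {Fin.zero} {Fin.zero} _ _ → Relation.Binary.PropositionalEquality.refl } }
  ; dec≤ = λ _ _ → Relation.Nullary.yes Data.Unit.tt }
  where import Relation.Nullary

Contractible : FinT0 → Set
Contractible X = HomotopyEquivalent X pointT0

-- 𝔖ⁿ as the poset {0,1}ⁿ with the product order; on 𝔖 = {0,1} the order
-- is 0 ≤ 1 (false ≤ true), since {0} is the only proper nonempty open set.
Sierp^ : ℕ → Set
Sierp^ n = Fin n → Bool

_≤𝔖ⁿ_ : ∀ {n} → Sierp^ n → Sierp^ n → Set
u ≤𝔖ⁿ v = ∀ i → u i B.≤ v i

-- X is homeomorphic to a subspace of 𝔖ⁿ: an order embedding X → {0,1}ⁿ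
-- (injectivity follows from antisymmetry of X).
EmbedsInSⁿ : FinT0 → ℕ → Set
EmbedsInSⁿ X n = Σ (Fin (card X) → Sierp^ n) λ e →
  ∀ x y → (_≤_ X x y → e x ≤𝔖ⁿ e y) × (e x ≤𝔖ⁿ e y → _≤_ X x y)

-- d(X) ≤ m  iff  X embeds in 𝔖ᵐ  (𝔖ᵏ ⊆ 𝔖ᵐ for k ≤ m, so the set of n with
-- X ↪ 𝔖ⁿ is upward closed and d(X) is its minimum).
2dim≤ : FinT0 → ℕ → Set
2dim≤ X m = EmbedsInSⁿ X m

{-# OPTIONS --safe #-}

-- Call f : X → X embeddable when every retract Y of X on which r ∘ f is the identity
-- embeds into 𝔖 to the power |Y| - 1. A constant map is embeddable, as it forces Y to
-- be a point, and contractibility joins the constant map g ∘ f to id_X by a fence of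
-- comparable maps. Embeddability passes along each comparison f ~ f': if r ∘ f' = id_Y
-- but r ∘ f ≠ id_Y, then r ∘ f is a monotone self-map of Y comparable to id_Y, and an
-- extremal point z it moves is a beat point of Y. So Y ∖ z is a smaller retract with
-- r ∘ f' = id, and its embedding extends to Y by the single coordinate [z ≤ x] or
-- [x ≰ z]. For f = id_X and Y = X this is the theorem.

module Submission where

open import Defs
open import Level using (0ℓ)
open import Data.Nat using (ℕ; suc; _∸_)
open import Data.Fin using (Fin; zero; punchIn; punchOut; _≟_)
open import Data.Fin.Properties using (any?; punchIn-punchOut)
open import Data.Fin.Induction using (po-wellFounded)
open import Data.Fin.Subset using (Subset; _∈_; _⊂_)
open import Data.Fin.Subset.Induction using (⊂-wellFounded)
open import Data.Vec using (tabulate)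
open import Data.Vec.Properties using (lookup∘tabulate; lookup⇒[]=; []=⇒lookup)
open import Data.Vec.Functional using (updateAt; removeAt)
open import Data.Vec.Functional.Properties using (updateAt-updates; updateAt-minimal)
open import Data.Bool using (Bool; true; false; b≤b)
import Data.Bool as Bool
open import Data.Bool.Properties using (≤-minimum)
open import Data.Product using (∃; Σ; _×_; _,_; proj₁; proj₂)
open import Data.Sum using (inj₁; inj₂; _⊎_)
open import Data.Empty using (⊥-elim)
open import Function using (_∘_; id; const; flip)
open import Induction.WellFounded using (Acc; acc)
open import Relation.Unary using (Pred)
import Relation.Unary as Unary
open import Relation.Binary using (Rel; Decidable; IsPartialOrder)
import Relation.Binary.Construct.Flip.EqAndOrd as Flip
import Relation.Binary.Construct.NonStrictToStrict as ToStrict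
open import Relation.Binary.Construct.Closure.ReflexiveTransitive using (ε; _◅_)
open import Relation.Nullary using (¬_; Dec; yes; no; does)
open import Relation.Nullary.Decidable using (dec-true; decidable-stable; ¬?; _×-dec_)
open import Relation.Binary.PropositionalEquality

private
  variable
    A B : Set

does-mono : (a? : Dec A) (b? : Dec B) → (A → B) → does a? Bool.≤ does b?
does-mono (yes _) (yes _) _   = b≤b
does-mono (yes a) (no ¬b) a→b = ⊥-elim (¬b (a→b a))
does-mono (no _)  b?      _   = ≤-minimum (does b?)

does-≤⇒ : (a? : Dec A) (b? : Dec B) → does a? Bool.≤ does b? → A → B
does-≤⇒ (yes _) (yes b) _ _ = b
does-≤⇒ (no ¬a) _       _ a = ⊥-elim (¬a a)

does≡true⇒ : (a? : Dec A) → does a? ≡ true → A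
does≡true⇒ (yes a) _ = a

module _ {n : ℕ} {u v : Sierp^ n} where

  ≤𝔖ⁿ-updateAt : ∀ i {a b} → a Bool.≤ b → u ≤𝔖ⁿ v →
                 updateAt u i (const a) ≤𝔖ⁿ updateAt v i (const b)
  ≤𝔖ⁿ-updateAt i a≤b u≤v j with j ≟ i
  ... | yes refl =
    subst₂ Bool._≤_ (sym (updateAt-updates i u)) (sym (updateAt-updates i v)) a≤b
  ... | no j≢i   =
    subst₂ Bool._≤_ (sym (updateAt-minimal j i u j≢i)) (sym (updateAt-minimal j i v j≢i)) (u≤v j)

  ≤𝔖ⁿ-updateAt⁻ : ∀ i {a b} → u i ≡ false →
                  updateAt u i (const a) ≤𝔖ⁿ updateAt v i (const b) → a Bool.≤ b × u ≤𝔖ⁿ v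
  ≤𝔖ⁿ-updateAt⁻ i {a} {b} uᵢ≡false le = at-i , off-i
    where
    at-i : a Bool.≤ b
    at-i = subst₂ Bool._≤_ (updateAt-updates i u) (updateAt-updates i v) (le i)
    off-i : u ≤𝔖ⁿ v
    off-i j with j ≟ i
    ... | yes refl rewrite uᵢ≡false = ≤-minimum (v j)
    ... | no j≢i   =
      subst₂ Bool._≤_ (updateAt-minimal j i u j≢i) (updateAt-minimal j i v j≢i) (le j)

≤𝔖ⁿ-removeAt⁻ : ∀ {n} {u v : Sierp^ (suc n)} i → u i ≡ false →
                removeAt u i ≤𝔖ⁿ removeAt v i → u ≤𝔖ⁿ v
≤𝔖ⁿ-removeAt⁻ {u = u} {v} i uᵢ≡false le j with i ≟ j
... | yes refl rewrite uᵢ≡false = ≤-minimum (v i)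
... | no i≢j   = subst₂ Bool._≤_ (cong u (punchIn-punchOut i≢j)) (cong v (punchIn-punchOut i≢j))
                         (le (punchOut i≢j))

OrderEmbedding : ∀ {n} → Rel A 0ℓ → (A → Sierp^ n) → Set
OrderEmbedding _≺_ e = ∀ x y → (x ≺ y → e x ≤𝔖ⁿ e y) × (e x ≤𝔖ⁿ e y → x ≺ y)

orderEmbedding-removeAt : ∀ {n} {_≺_ : Rel A 0ℓ} (e : A → Sierp^ n) (i : Fin n) →
  (∀ x → e x i ≡ false) → OrderEmbedding _≺_ e →
  Σ (A → Sierp^ (n ∸ 1)) (OrderEmbedding _≺_)
orderEmbedding-removeAt {n = suc _} e i vanish emb =
  (λ x → removeAt (e x) i) ,
  λ x y → (λ x≺y → proj₁ (emb x y) x≺y ∘ punchIn i) ,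
          (λ le → proj₂ (emb x y) (≤𝔖ⁿ-removeAt⁻ i (vanish x) le))

module _ {m : ℕ} where

  collapse : Fin m → Fin m → Fin m → Fin m
  collapse z w u with u ≟ z
  ... | yes _ = w
  ... | no _  = u

  collapse-point : ∀ z w → collapse z w z ≡ w
  collapse-point z w with z ≟ z
  ... | yes _   = refl
  ... | no z≢z = ⊥-elim (z≢z refl)

  collapse-other : ∀ {z w u} → u ≢ z → collapse z w u ≡ u
  collapse-other {z} {u = u} u≢z with u ≟ z
  ... | yes u≡z = ⊥-elim (u≢z u≡z)
  ... | no _    = refl

  collapse-preserves : ∀ {ℓ} (P : Pred (Fin m) ℓ) {z w u} → P w → P u → P (collapse z w u)
  collapse-preserves P {z} {u = u} Pw Pu with u ≟ z
  ... | yes _ = Pw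
  ... | no _  = Pu

  collapse-idem : ∀ {z w} u → w ≢ z → collapse z w (collapse z w u) ≡ collapse z w u
  collapse-idem {z} u w≢z with u ≟ z
  ... | yes _   = collapse-other w≢z
  ... | no u≢z = collapse-other u≢z

module BeatPoints {m : ℕ} {_≼_ : Rel (Fin m) 0ℓ}
  (isPO : IsPartialOrder _≡_ _≼_) (_≼?_ : Decidable _≼_)
  {Y : Pred (Fin m) 0ℓ} (Y? : Unary.Decidable Y) where

  open IsPartialOrder isPO using () renaming (refl to ≼-refl; trans to ≼-trans)
  open ToStrict _≡_ _≼_ using (_<_; <-decidable)

  record DownBeatPoint : Set where
    field
      point target   : Fin m
      point∈Y        : Y point
      target∈Y       : Y target
      target<point   : target < point
      below⇒≼target : ∀ {u} → Y u → u < point → u ≼ target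

  minimal : ∀ {ℓ} {Q : Pred (Fin m) ℓ} → Unary.Decidable Q →
            ∀ {y} → Q y → ∃ λ z → Q z × (∀ {u} → u < z → ¬ Q u)
  minimal {Q = Q} Q? {y} = descend (po-wellFounded isPO y)
    where
    descend : ∀ {y} → Acc _<_ y → Q y → ∃ λ z → Q z × (∀ {u} → u < z → ¬ Q u)
    descend {y} (acc below) Qy with any? (λ u → <-decidable _≟_ _≼?_ u y ×-dec Q? u)
    ... | yes (u , u<y , Qu) = descend (below u<y) Qu
    ... | no none            = y , Qy , λ u<y Qu → none (_ , u<y , Qu)

  -- A point moved by g and minimal with this property is a beat point: everything
  -- strictly below it is fixed by g, hence lies below its image.
  deflationary⇒downBeatPoint : (g : Fin m → Fin m) →
    (∀ {y} → Y y → Y (g y)) → (∀ {x y} → x ≼ y → g x ≼ g y) → (∀ {y} → Y y → g y ≼ y) →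
    ∀ {y} → Y y → g y ≢ y → DownBeatPoint
  deflationary⇒downBeatPoint g g-closed g-mono g-deflationary Yy gy≢y = record
    { point         = z
    ; target        = g z
    ; point∈Y       = Yz
    ; target∈Y      = g-closed Yz
    ; target<point  = g-deflationary Yz , gz≢z
    ; below⇒≼target = λ {u} Yu u<z →
        subst (_≼ g z) (fixed Yu u<z) (g-mono (proj₁ u<z))
    }
    where
    minimalMoved : ∃ λ z → (Y z × g z ≢ z) × (∀ {u} → u < z → ¬ (Y u × g u ≢ u))
    minimalMoved = minimal (λ u → Y? u ×-dec ¬? (g u ≟ u)) (Yy , gy≢y)
    z = proj₁ minimalMoved
    Yz = proj₁ (proj₁ (proj₂ minimalMoved))
    gz≢z = proj₂ (proj₁ (proj₂ minimalMoved))
    fixed : ∀ {u} → Y u → u < z → g u ≡ u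
    fixed Yu u<z = decidable-stable (g _ ≟ _) λ gu≢u →
      proj₂ (proj₂ minimalMoved) u<z (Yu , gu≢u)

  module _ (β : DownBeatPoint) where
    open DownBeatPoint β

    private
      c = collapse point target

    collapse-≼ : ∀ u → c u ≼ u
    collapse-≼ u with u ≟ point
    ... | yes refl = proj₁ target<point
    ... | no _     = ≼-refl

    collapse-mono : ∀ {x y} → Y x → x ≼ y → c x ≼ c y
    collapse-mono {x} {y} Yx x≼y with x ≟ point | y ≟ point
    ... | yes refl | yes refl = ≼-refl
    ... | yes refl | no _     = ≼-trans (proj₁ target<point) x≼y
    ... | no x≢z   | yes refl = below⇒≼target Yx (x≼y , x≢z)
    ... | no _     | no _     = x≼y

    collapse-reflect : ∀ {x y} → c x ≼ c y → (point ≼ x → point ≼ y) → x ≼ y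
    collapse-reflect {x} {y} cx≼cy up with x ≟ point
    ... | yes refl = up ≼-refl
    ... | no _     = ≼-trans cx≼cy (collapse-≼ y)

module _ (X : FinT0) where

  private
    n = card X
    F = Fin n

    _⊑_ : F → F → Set
    _⊑_ = _≤_ X

    _⊑?_ : Decidable _⊑_
    _⊑?_ = dec≤ X

  open IsPartialOrder (isPO X) using () renaming (reflexive to ⊑-reflexive; trans to ⊑-trans)

  record Retraction : Set where
    field
      retract      : F → F
      retract-mono : ∀ {x y} → x ⊑ y → retract x ⊑ retract y
      retract-idem : ∀ x → retract (retract x) ≡ retract x

  open Retraction

  idRetraction : Retraction
  idRetraction = record { retract = id ; retract-mono = id ; retract-idem = λ _ → refl }

  Fixed : Retraction → Pred F 0ℓ
  Fixed R y = retract R y ≡ y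

  Fixed? : ∀ R → Unary.Decidable (Fixed R)
  Fixed? R y = retract R y ≟ y

  image : Retraction → Subset n
  image R = tabulate (does ∘ Fixed? R)

  fixed⇒∈image : ∀ R {x} → Fixed R x → x ∈ image R
  fixed⇒∈image R {x} Rx≡x =
    lookup⇒[]= x (image R) (trans (lookup∘tabulate _ x) (dec-true (Fixed? R x) Rx≡x))

  ∈image⇒fixed : ∀ R {x} → x ∈ image R → Fixed R x
  ∈image⇒fixed R {x} x∈R =
    does≡true⇒ (Fixed? R x) (trans (sym (lookup∘tabulate _ x)) ([]=⇒lookup x∈R))

  IdentityOnImage : Retraction → (F → F) → Set
  IdentityOnImage R f = ∀ y → Fixed R y → retract R (f y) ≡ y

  identityOnImage⊎moved : ∀ R f →
    IdentityOnImage R f ⊎ ∃ λ y → Fixed R y × retract R (f y) ≢ y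
  identityOnImage⊎moved R f with any? (λ y → Fixed? R y ×-dec ¬? (retract R (f y) ≟ y))
  ... | yes moved = inj₂ moved
  ... | no none   = inj₁ λ y Ry≡y →
    decidable-stable (retract R (f y) ≟ y) (λ moves → none (y , Ry≡y , moves))

  -- Up or down; the coordinate is [point ⊑ x] for a down beat point and [x ⋢ point]
  -- for an up one.
  record BeatPoint (R : Retraction) : Set where
    field
      point target  : F
      point-fixed   : Fixed R point
      target-fixed  : Fixed R target
      target≢point  : target ≢ point
      collapse-mono : ∀ {x y} → Fixed R x → Fixed R y → x ⊑ y →
                      collapse point target x ⊑ collapse point target y
      coordinate      : F → Bool
      coordinate-mono : ∀ {x y} → x ⊑ y → coordinate x Bool.≤ coordinate y
      collapse-coordinate-reflect : ∀ {x y} → collapse point target x ⊑ collapse point target y →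
                                    coordinate x Bool.≤ coordinate y → x ⊑ y

  module _ (R : Retraction) where

    private
      module Down = BeatPoints (isPO X) _⊑?_ (Fixed? R)
      module Up   = BeatPoints (Flip.isPartialOrder (isPO X)) (flip _⊑?_) (Fixed? R)

    downBeatPoint : Down.DownBeatPoint → BeatPoint R
    downBeatPoint β = record
      { point           = point
      ; target          = target
      ; point-fixed     = point∈Y
      ; target-fixed    = target∈Y
      ; target≢point    = proj₂ target<point
      ; collapse-mono   = λ Rx _ → Down.collapse-mono β Rx
      ; coordinate      = λ x → does (point ⊑? x)
      ; coordinate-mono = λ x⊑y → does-mono (point ⊑? _) (point ⊑? _) (λ z⊑x → ⊑-trans z⊑x x⊑y)
      ; collapse-coordinate-reflect = λ cx⊑cy b≤ →
          Down.collapse-reflect β cx⊑cy (does-≤⇒ (point ⊑? _) (point ⊑? _) b≤)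
      }
      where open Down.DownBeatPoint β

    upBeatPoint : Up.DownBeatPoint → BeatPoint R
    upBeatPoint β = record
      { point           = point
      ; target          = target
      ; point-fixed     = point∈Y
      ; target-fixed    = target∈Y
      ; target≢point    = proj₂ target<point
      ; collapse-mono   = λ _ Ry x⊑y → Up.collapse-mono β Ry x⊑y
      ; coordinate      = λ x → does (¬? (x ⊑? point))
      ; coordinate-mono = λ x⊑y → does-mono (¬? (_ ⊑? point)) (¬? (_ ⊑? point))
                                    (λ x⋢z y⊑z → x⋢z (⊑-trans x⊑y y⊑z))
      ; collapse-coordinate-reflect = λ {x} cx⊑cy b≤ → Up.collapse-reflect β cx⊑cy λ y⊑z →
          decidable-stable (x ⊑? point) λ x⋢z →
            does-≤⇒ (¬? (x ⊑? point)) (¬? (_ ⊑? point)) b≤ x⋢z y⊑z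
      }
      where open Up.DownBeatPoint β

    beatPoint : ∀ {f f'} → Comparable X X f f' → IdentityOnImage R (proj₁ f') →
                ∀ {y} → Fixed R y → retract R (proj₁ f y) ≢ y → BeatPoint R
    beatPoint {f , f-mono} (inj₁ f≤f') idOn-f' Ry≡y moved =
      downBeatPoint (Down.deflationary⇒downBeatPoint (retract R ∘ f)
        (λ _ → retract-idem R _) (retract-mono R ∘ f-mono)
        (λ {y} Ry≡y → subst (retract R (f y) ⊑_) (idOn-f' y Ry≡y) (retract-mono R (f≤f' y)))
        Ry≡y moved)
    beatPoint {f , f-mono} (inj₂ f'≤f) idOn-f' Ry≡y moved =
      upBeatPoint (Up.deflationary⇒downBeatPoint (retract R ∘ f)
        (λ _ → retract-idem R _) (retract-mono R ∘ f-mono)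
        (λ {y} Ry≡y → subst (_⊑ retract R (f y)) (idOn-f' y Ry≡y) (retract-mono R (f'≤f y)))
        Ry≡y moved)

  module _ (R : Retraction) (β : BeatPoint R) where
    open BeatPoint β

    private
      c = collapse point target

      c-fixed : ∀ {u} → Fixed R u → Fixed R (c u)
      c-fixed = collapse-preserves (Fixed R) target-fixed

    _∖_ : Retraction
    _∖_ = record
      { retract      = c ∘ retract R
      ; retract-mono = λ x⊑y →
          collapse-mono (retract-idem R _) (retract-idem R _) (retract-mono R x⊑y)
      ; retract-idem = λ x →
          trans (cong c (c-fixed (retract-idem R x))) (collapse-idem (retract R x) target≢point)
      }

    ∖-fixed⇒fixed : ∀ {u} → Fixed _∖_ u → Fixed R u
    ∖-fixed⇒fixed R'u≡u = subst (Fixed R) R'u≡u (c-fixed (retract-idem R _))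

    point-unfixed : ¬ Fixed _∖_ point
    point-unfixed R'z≡z = target≢point (begin
      target              ≡⟨ sym (collapse-point point target) ⟩
      c point             ≡⟨ cong c (sym point-fixed) ⟩
      c (retract R point) ≡⟨ R'z≡z ⟩
      point               ∎)
      where open ≡-Reasoning

    collapse-fixed : ∀ {x} → Fixed R x → Fixed _∖_ (c x)
    collapse-fixed {x} Rx≡x = trans (cong c (c-fixed Rx≡x)) (collapse-idem x target≢point)

    image-∖ : image _∖_ ⊂ image R
    image-∖ = fixed⇒∈image R ∘ ∖-fixed⇒fixed ∘ ∈image⇒fixed _∖_
            , point , fixed⇒∈image R point-fixed , point-unfixed ∘ ∈image⇒fixed _∖_

    identityOnImage-∖ : ∀ {f} → IdentityOnImage R f → IdentityOnImage _∖_ f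
    identityOnImage-∖ idOn-f y R'y≡y =
      trans (cong c (trans (idOn-f y Ry≡y) (sym Ry≡y))) R'y≡y
      where Ry≡y = ∖-fixed⇒fixed R'y≡y

  -- Coordinates are indexed by the points of X and vanish outside Y ∖ {base}, so this
  -- embeds Y into 𝔖 to the power |Y| - 1 without counting Y.
  record SierpinskiEmbedding (Y : Pred F 0ℓ) : Set where
    field
      base           : F
      base∈Y         : Y base
      embed          : F → Sierp^ n
      embed-mono     : ∀ {x y} → Y x → Y y → x ⊑ y → embed x ≤𝔖ⁿ embed y
      embed-reflect  : ∀ {x y} → Y x → Y y → embed x ≤𝔖ⁿ embed y → x ⊑ y
      vanish-outside : ∀ x {u} → ¬ Y u → embed x u ≡ false
      vanish-base    : ∀ x → embed x base ≡ false

  singletonEmbedding : ∀ {Y q} → Y q → (∀ {y} → Y y → y ≡ q) → SierpinskiEmbedding Y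
  singletonEmbedding {q = q} Yq unique = record
    { base           = q
    ; base∈Y         = Yq
    ; embed          = λ _ _ → false
    ; embed-mono     = λ _ _ _ _ → b≤b
    ; embed-reflect  = λ Yx Yy _ → ⊑-reflexive (trans (unique Yx) (sym (unique Yy)))
    ; vanish-outside = λ _ _ → refl
    ; vanish-base    = λ _ → refl
    }

  sierpinskiEmbedding-∖ : ∀ R (β : BeatPoint R) →
    SierpinskiEmbedding (Fixed (R ∖ β)) → SierpinskiEmbedding (Fixed R)
  sierpinskiEmbedding-∖ R β E = record
    { base           = base
    ; base∈Y         = ∖-fixed⇒fixed R β base∈Y
    ; embed          = embed′
    ; embed-mono     = λ Rx Ry x⊑y →
        ≤𝔖ⁿ-updateAt point (coordinate-mono x⊑y)
          (embed-mono (collapse-fixed R β Rx) (collapse-fixed R β Ry) (collapse-mono Rx Ry x⊑y))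
    ; embed-reflect  = λ {x} Rx Ry le →
        let b≤ , e≤ = ≤𝔖ⁿ-updateAt⁻ point (vanish-outside (c x) (point-unfixed R β)) le
        in collapse-coordinate-reflect
             (embed-reflect (collapse-fixed R β Rx) (collapse-fixed R β Ry) e≤) b≤
    ; vanish-outside = λ x {u} ¬Ru →
        trans (updateAt-minimal u point _ (λ { refl → ¬Ru point-fixed }))
              (vanish-outside (c x) (¬Ru ∘ ∖-fixed⇒fixed R β))
    ; vanish-base    = λ x →
        trans (updateAt-minimal base point _ (λ { refl → point-unfixed R β base∈Y }))
              (vanish-base (c x))
    }
    where
    open BeatPoint β
    open SierpinskiEmbedding E
    c = collapse point target
    embed′ : F → Sierp^ n
    embed′ x = updateAt (embed (c x)) point (const (coordinate x))

  Embeddable : Map X X → Set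
  Embeddable f = ∀ R → IdentityOnImage R (proj₁ f) → SierpinskiEmbedding (Fixed R)

  embeddable-const : ∀ c → (∀ x y → proj₁ c x ≡ proj₁ c y) → F → Embeddable c
  embeddable-const c constant p R idOn-c = singletonEmbedding (retract-idem R (proj₁ c p))
    λ {y} Ry≡y → trans (sym (idOn-c y Ry≡y)) (cong (retract R) (constant y p))

  embeddable-comparable : ∀ {f f'} → Comparable X X f f' → Embeddable f → Embeddable f'
  embeddable-comparable {f} {f'} f~f' embeddable-f R = shrink R (⊂-wellFounded (image R))
    where
    shrink : ∀ R → Acc _⊂_ (image R) → IdentityOnImage R (proj₁ f') →
             SierpinskiEmbedding (Fixed R)
    shrink R (acc smaller) idOn-f' with identityOnImage⊎moved R (proj₁ f)
    ... | inj₁ idOn-f               = embeddable-f R idOn-f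
    ... | inj₂ (y , Ry≡y , moved) = sierpinskiEmbedding-∖ R β
      (shrink (R ∖ β) (smaller (image-∖ R β)) (identityOnImage-∖ R β idOn-f'))
      where β = beatPoint R {f} {f'} f~f' idOn-f' Ry≡y moved

  embeddable-homotopic : ∀ {f f'} → Homotopic X X f f' → Embeddable f → Embeddable f'
  embeddable-homotopic ε = id
  embeddable-homotopic {f} {f'} (_◅_ {j = f₁} f~f₁ f₁≃f') =
    embeddable-homotopic {f₁} {f'} f₁≃f' ∘ embeddable-comparable {f} {f₁} f~f₁

  embedsInSⁿ : SierpinskiEmbedding (Fixed idRetraction) → EmbedsInSⁿ X (n ∸ 1)
  embedsInSⁿ E = orderEmbedding-removeAt embed base vanish-base
    λ x y → embed-mono refl refl , embed-reflect refl refl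
    where open SierpinskiEmbedding E

mainTheorem4 : (X : FinT0) → Contractible X → 2dim≤ X (card X ∸ 1)
mainTheorem4 X (f , g , gf≃id , _) = embedsInSⁿ X
  (embeddable-homotopic X gf≃id (embeddable-const X gf constant (proj₁ g zero))
    (idRetraction X) (λ _ y≡y → y≡y))
  where
  gf = comp X pointT0 X g f
  constant : ∀ x y → proj₁ gf x ≡ proj₁ gf y
  constant x y with proj₁ f x | proj₁ f y
  ... | zero | zero = refl
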